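{- In $\mathsf T_\Sigma$, for all polynomials $P,Q$ and tapes $t_1,t_2:P\to Q$, and tapes $\mathfrak s$ of appropriate types, the following hold: (1) $(t_1+t_2);\mathfrak s=(t_1;\mathfrak s)+(t_2;\mathfrak s)$; (2) $\mathfrak s;(t_1+t_2)=(\mathfrak s;t_1)+(\mathfrak s;t_2)$; (3) $\mathfrak o;\mathfrak s=\mathfrak o=\mathfrak s;\mathfrak o$; (4) $(t_1+t_2)\otimes\mathfrak s=(t_1\otimes\mathfrak s)+(t_2\otimes\mathfrak s)$; (5) $\mathfrak s\otimes(t_1+t_2)=(\mathfrak s\otimes t_1)+(\mathfrak s\otimes t_2)$; (6) $\mathfrak o\otimes\mathfrak s=\mathfrak o=\mathfrak s\otimes\mathfrak o$ (each $\mathfrak o$ of the appropriate type).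
   Context: Monoidal signature $(\mathcal S,\Sigma)$; $\mathsf C_\Sigma$ the free strict symmetric monoidal category on it (objects words over $\mathcal S$, $\otimes$ concatenation). A finite biproduct (fb) category: symmetric monoidal $(\mathsf C,\oplus,0)$ with natural commutative monoids $\nabla_X:X\oplus X\to X$, $\mathsf i_X:0\to X$ and cocommutative comonoids $\Delta_X:X\to X\oplus X$, $!_X:X\to0$ coherent with $\oplus$. $\mathsf T_\Sigma$: free strict fb category on the underlying category of $\mathsf C_\Sigma$; objects polynomials $U_1\oplus\cdots\oplus U_n$ ($U_i\in\mathcal S^\star$); arrows (tapes) terms in $\mathrm{id}$, $\lceil c\rceil$, $\sigma^\oplus$, $\Delta,!,\nabla,\mathsf i$, $;$, $\oplus$ modulo fb laws, naturality w.r.t. $\lceil c\rceil$, $\lceil\mathrm{id}\rceil=\mathrm{id}$, $\lceil c;d\rceil=\lceil c\rceil;\lceil d\rceil$ ((co)monoids on arbitrary polynomials built canonically). Tensor: $(\bigoplus_iU_i)\otimes(\bigoplus_jV_j)=\bigoplus_i\bigoplus_jU_iV_j$; for monomial $U$, $L_U,R_U$ preserve $;$, $\oplus$, $\mathrm{id}_0$ with $L_U(\lceil c\rceil)=\lceil\mathrm{id}_U\otimes c\rceil$, $R_U(\lceil c\rceil)=\lceil c\otimes\mathrm{id}_U\rceil$, $L_U(\sigma^\oplus_{V,W})=\sigma^\oplus_{UV,UW}$, $R_U(\sigma^\oplus_{V,W})=\sigma^\oplus_{VU,WU}$, $L_U(\Delta_V)=\Delta_{UV}$, $R_U(\Delta_V)=\Delta_{VU}$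 etc.; $\delta^l_{0,Q,R}=\mathrm{id}_0$, $\delta^l_{U\oplus P',Q,R}=(\mathrm{id}\oplus\delta^l_{P',Q,R});(\mathrm{id}_{UQ}\oplus\sigma^\oplus_{UR,P'Q}\oplus\mathrm{id}_{P'R})$; $L_0=R_0=\mathrm{id}_0$, $L_{W\oplus S'}(t)=L_W(t)\oplus L_{S'}(t)$, $R_{W\oplus S'}(t)=\delta^l_{P,W,S'};(R_W(t)\oplus R_{S'}(t));(\delta^l_{Q,W,S'})^{ -1}$; $t_1\otimes t_2=L_{P_1}(t_2);R_{Q_2}(t_1)$. For $t_1,t_2:P\to Q$: $t_1+t_2=\Delta_P;(t_1\oplus t_2);\nabla_Q$ and $\mathfrak o_{P,Q}=!_P;\mathsf i_Q$. -}

module Defs where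

open import Data.List using (List; []; _∷_; _++_; map; [_])
open import Data.List.Properties using (++-assoc; ++-identityʳ; map-++)
open import Relation.Binary.PropositionalEquality
  using (_≡_; refl; sym; trans; cong; cong₂; subst₂; module ≡-Reasoning)

record Signature : Set₁ where
  field
    Sort : Set
    Gen  : List Sort → List Sort → Set

interchange-eq : ∀ {A : Set} (a b c d : List A) →
                 a ++ ((b ++ c) ++ d) ≡ (a ++ b) ++ (c ++ d)
interchange-eq a b c d = begin
    a ++ ((b ++ c) ++ d)   ≡⟨ cong (a ++_) (++-assoc b c d) ⟩
    a ++ (b ++ (c ++ d))   ≡⟨ sym (++-assoc a b (c ++ d)) ⟩
    (a ++ b) ++ (c ++ d)   ∎
  where open ≡-Reasoning

module FreeFB (Sg : Signature) where
  open Signature Sg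

  -- C_Σ : the free strict symmetric monoidal category on (S, Σ).
  -- Objects: words over S; ⊗ on objects: concatenation.

  Word : Set
  Word = List Sort

  infixr 9 _⨾ᶜ_
  infixr 10 _⊗ᶜ_

  data Circ : Word → Word → Set where
    idᶜ   : (U : Word) → Circ U U
    gen   : ∀ {U V} → Gen U V → Circ U V
    σᶜ    : (U V : Word) → Circ (U ++ V) (V ++ U)
    _⨾ᶜ_  : ∀ {U V W} → Circ U V → Circ V W → Circ U W
    _⊗ᶜ_  : ∀ {U V U' V'} → Circ U V → Circ U' V' → Circ (U ++ U') (V ++ V')

  castᶜ : ∀ {U U' V V'} → U ≡ U' → V ≡ V' → Circ U V → Circ U' V'
  castᶜ p q c = subst₂ Circ p q c

  infix 4 _≈ᶜ_
  data _≈ᶜ_ : ∀ {U V} → Circ U V → Circ U V → Set where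
    ≈ᶜ-refl  : ∀ {U V} {c : Circ U V} → c ≈ᶜ c
    ≈ᶜ-sym   : ∀ {U V} {c d : Circ U V} → c ≈ᶜ d → d ≈ᶜ c
    ≈ᶜ-trans : ∀ {U V} {c d e : Circ U V} → c ≈ᶜ d → d ≈ᶜ e → c ≈ᶜ e
    ⨾ᶜ-cong  : ∀ {U V W} {c c' : Circ U V} {d d' : Circ V W} →
               c ≈ᶜ c' → d ≈ᶜ d' → (c ⨾ᶜ d) ≈ᶜ (c' ⨾ᶜ d')
    ⊗ᶜ-cong  : ∀ {U V U' V'} {c c' : Circ U V} {d d' : Circ U' V'} →
               c ≈ᶜ c' → d ≈ᶜ d' → (c ⊗ᶜ d) ≈ᶜ (c' ⊗ᶜ d')
    idˡᶜ     : ∀ {U V} (c : Circ U V) → (idᶜ U ⨾ᶜ c) ≈ᶜ c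
    idʳᶜ     : ∀ {U V} (c : Circ U V) → (c ⨾ᶜ idᶜ V) ≈ᶜ c
    assocᶜ   : ∀ {U V W X} (c : Circ U V) (d : Circ V W) (e : Circ W X) →
               ((c ⨾ᶜ d) ⨾ᶜ e) ≈ᶜ (c ⨾ᶜ (d ⨾ᶜ e))
    ⊗ᶜ-id    : (U V : Word) → (idᶜ U ⊗ᶜ idᶜ V) ≈ᶜ idᶜ (U ++ V)
    ⊗ᶜ-interchange : ∀ {U V W U' V' W'}
               (c : Circ U V) (d : Circ V W) (c' : Circ U' V') (d' : Circ V' W') →
               ((c ⨾ᶜ d) ⊗ᶜ (c' ⨾ᶜ d')) ≈ᶜ ((c ⊗ᶜ c') ⨾ᶜ (d ⊗ᶜ d'))
    ⊗ᶜ-assoc : ∀ {U V U' V' U'' V''}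
               (c : Circ U V) (d : Circ U' V') (e : Circ U'' V'') →
               castᶜ (++-assoc U U' U'') (++-assoc V V' V'') ((c ⊗ᶜ d) ⊗ᶜ e)
                 ≈ᶜ (c ⊗ᶜ (d ⊗ᶜ e))
    ⊗ᶜ-unitˡ : ∀ {U V} (c : Circ U V) → (idᶜ [] ⊗ᶜ c) ≈ᶜ c
    ⊗ᶜ-unitʳ : ∀ {U V} (c : Circ U V) →
               castᶜ (++-identityʳ U) (++-identityʳ V) (c ⊗ᶜ idᶜ []) ≈ᶜ c
    σᶜ-nat   : ∀ {U V U' V'} (c : Circ U V) (d : Circ U' V') →
               ((c ⊗ᶜ d) ⨾ᶜ σᶜ V V') ≈ᶜ (σᶜ U U' ⨾ᶜ (d ⊗ᶜ c))
    σᶜ-inv   : (U V : Word) → (σᶜ U V ⨾ᶜ σᶜ V U) ≈ᶜ idᶜ (U ++ V)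
    σᶜ-unit  : (U : Word) →
               σᶜ U [] ≈ᶜ castᶜ (sym (++-identityʳ U)) refl (idᶜ U)
    σᶜ-hex   : (U V W : Word) →
               σᶜ U (V ++ W) ≈ᶜ
               castᶜ (++-assoc U V W) (sym (++-assoc V W U))
                 ((σᶜ U V ⊗ᶜ idᶜ W) ⨾ᶜ
                  castᶜ (sym (++-assoc V U W)) refl (idᶜ V ⊗ᶜ σᶜ U W))

  -- T_Σ : the free strict finite-biproduct category on the underlying
  -- category of C_Σ.  Objects: polynomials U₁ ⊕ ⋯ ⊕ Uₙ (lists of words),
  -- ⊕ on objects: concatenation, 0 = [].

  Poly : Set
  Poly = List Word

  infixr 9 _⨾_
  infixr 10 _⊕_

  data Tape : Poly → Poly → Set where
    id   : (P : Poly) → Tape P P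
    ⌈_⌉  : ∀ {U V} → Circ U V → Tape [ U ] [ V ]
    σ⊕   : (P Q : Poly) → Tape (P ++ Q) (Q ++ P)
    Δ    : (P : Poly) → Tape P (P ++ P)
    !    : (P : Poly) → Tape P []
    ∇    : (P : Poly) → Tape (P ++ P) P
    ι    : (P : Poly) → Tape [] P
    _⨾_  : ∀ {P Q R} → Tape P Q → Tape Q R → Tape P R
    _⊕_  : ∀ {P Q P' Q'} → Tape P Q → Tape P' Q' → Tape (P ++ P') (Q ++ Q')

  castT : ∀ {P P' Q Q'} → P ≡ P' → Q ≡ Q' → Tape P Q → Tape P' Q'
  castT p q t = subst₂ Tape p q t

  infix 4 _≈_
  data _≈_ : ∀ {P Q} → Tape P Q → Tape P Q → Set where
    ≈-refl  : ∀ {P Q} {t : Tape P Q} → t ≈ t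
    ≈-sym   : ∀ {P Q} {t s : Tape P Q} → t ≈ s → s ≈ t
    ≈-trans : ∀ {P Q} {t s r : Tape P Q} → t ≈ s → s ≈ r → t ≈ r
    ⨾-cong  : ∀ {P Q R} {t t' : Tape P Q} {s s' : Tape Q R} →
              t ≈ t' → s ≈ s' → (t ⨾ s) ≈ (t' ⨾ s')
    ⊕-cong  : ∀ {P Q P' Q'} {t t' : Tape P Q} {s s' : Tape P' Q'} →
              t ≈ t' → s ≈ s' → (t ⊕ s) ≈ (t' ⊕ s')
    ⌈⌉-cong : ∀ {U V} {c d : Circ U V} → c ≈ᶜ d → ⌈ c ⌉ ≈ ⌈ d ⌉
    ⌈⌉-id   : (U : Word) → ⌈ idᶜ U ⌉ ≈ id [ U ]
    ⌈⌉-⨾    : ∀ {U V W} (c : Circ U V) (d : Circ V W) →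
              ⌈ c ⨾ᶜ d ⌉ ≈ (⌈ c ⌉ ⨾ ⌈ d ⌉)
    idˡ     : ∀ {P Q} (t : Tape P Q) → (id P ⨾ t) ≈ t
    idʳ     : ∀ {P Q} (t : Tape P Q) → (t ⨾ id Q) ≈ t
    assoc   : ∀ {P Q R S} (t : Tape P Q) (s : Tape Q R) (r : Tape R S) →
              ((t ⨾ s) ⨾ r) ≈ (t ⨾ (s ⨾ r))
    ⊕-id    : (P Q : Poly) → (id P ⊕ id Q) ≈ id (P ++ Q)
    ⊕-interchange : ∀ {P Q R P' Q' R'}
              (t : Tape P Q) (s : Tape Q R) (t' : Tape P' Q') (s' : Tape Q' R') →
              ((t ⨾ s) ⊕ (t' ⨾ s')) ≈ ((t ⊕ t') ⨾ (s ⊕ s'))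
    ⊕-assoc : ∀ {P Q P' Q' P'' Q''}
              (t : Tape P Q) (s : Tape P' Q') (r : Tape P'' Q'') →
              castT (++-assoc P P' P'') (++-assoc Q Q' Q'') ((t ⊕ s) ⊕ r)
                ≈ (t ⊕ (s ⊕ r))
    ⊕-unitˡ : ∀ {P Q} (t : Tape P Q) → (id [] ⊕ t) ≈ t
    ⊕-unitʳ : ∀ {P Q} (t : Tape P Q) →
              castT (++-identityʳ P) (++-identityʳ Q) (t ⊕ id []) ≈ t
    σ-nat   : ∀ {P Q P' Q'} (t : Tape P Q) (s : Tape P' Q') →
              ((t ⊕ s) ⨾ σ⊕ Q Q') ≈ (σ⊕ P P' ⨾ (s ⊕ t))
    σ-inv   : (P Q : Poly) → (σ⊕ P Q ⨾ σ⊕ Q P) ≈ id (P ++ Q)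
    σ-unit  : (P : Poly) → σ⊕ P [] ≈ castT (sym (++-identityʳ P)) refl (id P)
    σ-hex   : (P Q R : Poly) →
              σ⊕ P (Q ++ R) ≈
              castT (++-assoc P Q R) (sym (++-assoc Q R P))
                ((σ⊕ P Q ⊕ id R) ⨾
                 castT (sym (++-assoc Q P R)) refl (id Q ⊕ σ⊕ P R))
    ∇-assoc : (P : Poly) →
              ((∇ P ⊕ id P) ⨾ ∇ P) ≈
              castT (sym (++-assoc P P P)) refl ((id P ⊕ ∇ P) ⨾ ∇ P)
    ∇-unit  : (P : Poly) → ((ι P ⊕ id P) ⨾ ∇ P) ≈ id P
    ∇-comm  : (P : Poly) → (σ⊕ P P ⨾ ∇ P) ≈ ∇ P
    Δ-assoc : (P : Poly) →
              (Δ P ⨾ (Δ P ⊕ id P)) ≈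
              castT refl (sym (++-assoc P P P)) (Δ P ⨾ (id P ⊕ Δ P))
    Δ-unit  : (P : Poly) → (Δ P ⨾ (! P ⊕ id P)) ≈ id P
    Δ-comm  : (P : Poly) → (Δ P ⨾ σ⊕ P P) ≈ Δ P
    Δ-nat   : ∀ {P Q} (t : Tape P Q) → (t ⨾ Δ Q) ≈ (Δ P ⨾ (t ⊕ t))
    !-nat   : ∀ {P Q} (t : Tape P Q) → (t ⨾ ! Q) ≈ ! P
    ∇-nat   : ∀ {P Q} (t : Tape P Q) → (∇ P ⨾ t) ≈ ((t ⊕ t) ⨾ ∇ Q)
    ι-nat   : ∀ {P Q} (t : Tape P Q) → (ι P ⨾ t) ≈ ι Q
    Δ-⊕     : (P Q : Poly) →
              Δ (P ++ Q) ≈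
              ((Δ P ⊕ Δ Q) ⨾
               castT (interchange-eq P P Q Q) (interchange-eq P Q P Q)
                     (id P ⊕ (σ⊕ P Q ⊕ id Q)))
    Δ-0     : Δ [] ≈ id []
    !-⊕     : (P Q : Poly) → ! (P ++ Q) ≈ (! P ⊕ ! Q)
    !-0     : ! [] ≈ id []
    ∇-⊕     : (P Q : Poly) →
              ∇ (P ++ Q) ≈
              (castT (interchange-eq P Q P Q) (interchange-eq P P Q Q)
                     (id P ⊕ (σ⊕ Q P ⊕ id Q)) ⨾
               (∇ P ⊕ ∇ Q))
    ∇-0     : ∇ [] ≈ id []
    ι-⊕     : (P Q : Poly) → ι (P ++ Q) ≈ (ι P ⊕ ι Q)
    ι-0     : ι [] ≈ id []

  infixl 8 _+_
  _+_ : ∀ {P Q} → Tape P Q → Tape P Q → Tape P Q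
  _+_ {P} {Q} t₁ t₂ = Δ P ⨾ (t₁ ⊕ t₂) ⨾ ∇ Q

  𝔬 : (P Q : Poly) → Tape P Q
  𝔬 P Q = ! P ⨾ ι Q

  _·_ : Word → Poly → Poly
  U · P = map (U ++_) P

  _·ʳ_ : Poly → Word → Poly
  P ·ʳ U = map (_++ U) P

  infixr 11 _⊗ₚ_
  _⊗ₚ_ : Poly → Poly → Poly
  []      ⊗ₚ Q = []
  (U ∷ P) ⊗ₚ Q = (U · Q) ++ (P ⊗ₚ Q)

  ⊗ₚ-zeroʳ : (P : Poly) → P ⊗ₚ [] ≡ []
  ⊗ₚ-zeroʳ []      = refl
  ⊗ₚ-zeroʳ (U ∷ P) = ⊗ₚ-zeroʳ P

  ⊗ₚ-single : (P : Poly) (W : Word) → P ⊗ₚ [ W ] ≡ P ·ʳ W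
  ⊗ₚ-single []      W = refl
  ⊗ₚ-single (U ∷ P) W = cong ((U ++ W) ∷_) (⊗ₚ-single P W)

  L : (U : Word) → ∀ {P Q} → Tape P Q → Tape (U · P) (U · Q)
  L U (id P)    = id (U · P)
  L U ⌈ c ⌉     = ⌈ idᶜ U ⊗ᶜ c ⌉
  L U (σ⊕ P Q)  = castT (sym (map-++ (U ++_) P Q)) (sym (map-++ (U ++_) Q P))
                        (σ⊕ (U · P) (U · Q))
  L U (Δ P)     = castT refl (sym (map-++ (U ++_) P P)) (Δ (U · P))
  L U (! P)     = ! (U · P)
  L U (∇ P)     = castT (sym (map-++ (U ++_) P P)) refl (∇ (U · P))
  L U (ι P)     = ι (U · P)
  L U (t ⨾ s)   = L U t ⨾ L U s
  L U (_⊕_ {P} {Q} {P'} {Q'} t s) =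
    castT (sym (map-++ (U ++_) P P')) (sym (map-++ (U ++_) Q Q')) (L U t ⊕ L U s)

  R : (U : Word) → ∀ {P Q} → Tape P Q → Tape (P ·ʳ U) (Q ·ʳ U)
  R U (id P)    = id (P ·ʳ U)
  R U ⌈ c ⌉     = ⌈ c ⊗ᶜ idᶜ U ⌉
  R U (σ⊕ P Q)  = castT (sym (map-++ (_++ U) P Q)) (sym (map-++ (_++ U) Q P))
                        (σ⊕ (P ·ʳ U) (Q ·ʳ U))
  R U (Δ P)     = castT refl (sym (map-++ (_++ U) P P)) (Δ (P ·ʳ U))
  R U (! P)     = ! (P ·ʳ U)
  R U (∇ P)     = castT (sym (map-++ (_++ U) P P)) refl (∇ (P ·ʳ U))
  R U (ι P)     = ι (P ·ʳ U)
  R U (t ⨾ s)   = R U t ⨾ R U s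
  R U (_⊕_ {P} {Q} {P'} {Q'} t s) =
    castT (sym (map-++ (_++ U) P P')) (sym (map-++ (_++ U) Q Q')) (R U t ⊕ R U s)

  private
    e₁ : (U : Word) (P' Q R : Poly) →
         (U · Q) ++ (((U · R) ++ (P' ⊗ₚ Q)) ++ (P' ⊗ₚ R))
           ≡ (U · (Q ++ R)) ++ ((P' ⊗ₚ Q) ++ (P' ⊗ₚ R))
    e₁ U P' Q R = trans
      (cong ((U · Q) ++_) (++-assoc (U · R) (P' ⊗ₚ Q) (P' ⊗ₚ R)))
      (trans (sym (++-assoc (U · Q) (U · R) ((P' ⊗ₚ Q) ++ (P' ⊗ₚ R))))
             (cong (_++ ((P' ⊗ₚ Q) ++ (P' ⊗ₚ R))) (sym (map-++ (U ++_) Q R))))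

  δˡ : (P Q R : Poly) → Tape (P ⊗ₚ (Q ++ R)) ((P ⊗ₚ Q) ++ (P ⊗ₚ R))
  δˡ []       Q R = id []
  δˡ (U ∷ P') Q R =
    (id (U · (Q ++ R)) ⊕ δˡ P' Q R) ⨾
    castT (e₁ U P' Q R) (interchange-eq (U · Q) (P' ⊗ₚ Q) (U · R) (P' ⊗ₚ R))
      (id (U · Q) ⊕ (σ⊕ (U · R) (P' ⊗ₚ Q) ⊕ id (P' ⊗ₚ R)))

  δˡ⁻¹ : (P Q R : Poly) → Tape ((P ⊗ₚ Q) ++ (P ⊗ₚ R)) (P ⊗ₚ (Q ++ R))
  δˡ⁻¹ []       Q R = id []
  δˡ⁻¹ (U ∷ P') Q R =
    castT (interchange-eq (U · Q) (P' ⊗ₚ Q) (U · R) (P' ⊗ₚ R)) (e₁ U P' Q R)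
      (id (U · Q) ⊕ (σ⊕ (P' ⊗ₚ Q) (U · R) ⊕ id (P' ⊗ₚ R))) ⨾
    (id (U · (Q ++ R)) ⊕ δˡ⁻¹ P' Q R)

  Lₚ : (S : Poly) → ∀ {P Q} → Tape P Q → Tape (S ⊗ₚ P) (S ⊗ₚ Q)
  Lₚ []       t = id []
  Lₚ (W ∷ S') t = L W t ⊕ Lₚ S' t

  Rₚ : (S : Poly) → ∀ {P Q} → Tape P Q → Tape (P ⊗ₚ S) (Q ⊗ₚ S)
  Rₚ []       {P} {Q} t = castT (sym (⊗ₚ-zeroʳ P)) (sym (⊗ₚ-zeroʳ Q)) (id [])
  Rₚ (W ∷ S') {P} {Q} t =
    δˡ P [ W ] S' ⨾
    (castT (sym (⊗ₚ-single P W)) (sym (⊗ₚ-single Q W)) (R W t) ⊕ Rₚ S' t) ⨾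
    δˡ⁻¹ Q [ W ] S'

  infixr 10 _⊗_
  _⊗_ : ∀ {P₁ Q₁ P₂ Q₂} → Tape P₁ Q₁ → Tape P₂ Q₂ → Tape (P₁ ⊗ₚ P₂) (Q₁ ⊗ₚ Q₂)
  _⊗_ {P₁} {Q₁} {P₂} {Q₂} t₁ t₂ = Lₚ P₁ t₂ ⨾ Rₚ Q₂ t₁

-- Sum and zero are built from the biproduct (co)monoids, which are natural:
-- Δ-nat and ∇-nat make composition bilinear, and !-nat and ι-nat make 𝔬
-- absorbing.  The tensor t₁ ⊗ t₂ = Lₚ P₁ t₂ ⨾ Rₚ Q₂ t₁ is a composite of
-- whiskerings, so bilinearity of ⊗ reduces to bilinearity of Lₚ and Rₚ.  Each
-- whiskering is a ⊕ of the monomial whiskerings L, R (conjugated by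
-- distributors), which preserve + and 𝔬 on the nose up to casts.  What remains
-- is the interchange (a + b) ⊕ (c + d) ≈ (a ⊕ c) + (b ⊕ d), which comes from
-- the coherence of Δ and ∇ with ⊕ and the naturality of the middle-four swap.
module Submission where

open import Defs
open import Data.Product using (_×_; _,_; Σ)
open import Data.List using ([]; _∷_; _++_)
open import Data.List.Properties using (++-assoc)
open import Relation.Binary.Bundles using (Setoid)
open import Relation.Binary.PropositionalEquality using (_≡_; refl; trans; cong)
import Relation.Binary.Reasoning.Setoid as SetoidReasoning

module Distributivity (Sg : Signature) where
  open FreeFB Sg

  ≈-setoid : Poly → Poly → Setoid _ _
  ≈-setoid P Q = record
    { Carrier       = Tape P Q
    ; _≈_           = _≈_
    ; isEquivalence = record { refl = ≈-refl ; sym = ≈-sym ; trans = ≈-trans }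
    }

  module ≈-Reasoning {P Q : Poly} = SetoidReasoning (≈-setoid P Q)

  ⨾-congˡ : ∀ {P Q R} {t t' : Tape P Q} {s : Tape Q R} → t ≈ t' → (t ⨾ s) ≈ (t' ⨾ s)
  ⨾-congˡ h = ⨾-cong h ≈-refl

  ⨾-congʳ : ∀ {P Q R} {t : Tape P Q} {s s' : Tape Q R} → s ≈ s' → (t ⨾ s) ≈ (t ⨾ s')
  ⨾-congʳ h = ⨾-cong ≈-refl h

  ≡⇒≈ : ∀ {P Q} {t u : Tape P Q} → t ≡ u → t ≈ u
  ≡⇒≈ refl = ≈-refl

  !-unique : ∀ {P} (t : Tape P []) → t ≈ ! P
  !-unique t = ≈-trans (≈-sym (idʳ t)) (≈-trans (⨾-congʳ (≈-sym !-0)) (!-nat t))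

  ≈-into-empty : ∀ {P Q} → Q ≡ [] → (t u : Tape P Q) → t ≈ u
  ≈-into-empty refl t u = ≈-trans (!-unique t) (≈-sym (!-unique u))

  ⨾-distribʳ-+ : ∀ {P Q R} (t₁ t₂ : Tape P Q) (s : Tape Q R) →
                 ((t₁ + t₂) ⨾ s) ≈ ((t₁ ⨾ s) + (t₂ ⨾ s))
  ⨾-distribʳ-+ {P} {Q} {R} t₁ t₂ s = begin
    (Δ P ⨾ (t₁ ⊕ t₂) ⨾ ∇ Q) ⨾ s       ≈⟨ assoc _ _ _ ⟩
    Δ P ⨾ ((t₁ ⊕ t₂) ⨾ ∇ Q) ⨾ s       ≈⟨ ⨾-congʳ (assoc _ _ _) ⟩
    Δ P ⨾ (t₁ ⊕ t₂) ⨾ ∇ Q ⨾ s         ≈⟨ ⨾-congʳ (⨾-congʳ (∇-nat s)) ⟩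
    Δ P ⨾ (t₁ ⊕ t₂) ⨾ (s ⊕ s) ⨾ ∇ R   ≈⟨ ⨾-congʳ (≈-sym (assoc _ _ _)) ⟩
    Δ P ⨾ ((t₁ ⊕ t₂) ⨾ (s ⊕ s)) ⨾ ∇ R ≈⟨ ⨾-congʳ (⨾-congˡ (≈-sym (⊕-interchange _ _ _ _))) ⟩
    Δ P ⨾ ((t₁ ⨾ s) ⊕ (t₂ ⨾ s)) ⨾ ∇ R ∎
    where open ≈-Reasoning

  ⨾-distribˡ-+ : ∀ {P Q R} (t₁ t₂ : Tape P Q) (s : Tape R P) →
                 (s ⨾ (t₁ + t₂)) ≈ ((s ⨾ t₁) + (s ⨾ t₂))
  ⨾-distribˡ-+ {P} {Q} {R} t₁ t₂ s = begin
    s ⨾ Δ P ⨾ (t₁ ⊕ t₂) ⨾ ∇ Q         ≈⟨ ≈-sym (assoc _ _ _) ⟩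
    (s ⨾ Δ P) ⨾ (t₁ ⊕ t₂) ⨾ ∇ Q       ≈⟨ ⨾-congˡ (Δ-nat s) ⟩
    (Δ R ⨾ (s ⊕ s)) ⨾ (t₁ ⊕ t₂) ⨾ ∇ Q ≈⟨ assoc _ _ _ ⟩
    Δ R ⨾ (s ⊕ s) ⨾ (t₁ ⊕ t₂) ⨾ ∇ Q   ≈⟨ ⨾-congʳ (≈-sym (assoc _ _ _)) ⟩
    Δ R ⨾ ((s ⊕ s) ⨾ (t₁ ⊕ t₂)) ⨾ ∇ Q ≈⟨ ⨾-congʳ (⨾-congˡ (≈-sym (⊕-interchange _ _ _ _))) ⟩
    Δ R ⨾ ((s ⨾ t₁) ⊕ (s ⨾ t₂)) ⨾ ∇ Q ∎
    where open ≈-Reasoning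

  ⨾-zeroˡ : ∀ {P Q R} (s : Tape Q R) → (𝔬 P Q ⨾ s) ≈ 𝔬 P R
  ⨾-zeroˡ s = ≈-trans (assoc _ _ _) (⨾-congʳ (ι-nat s))

  ⨾-zeroʳ : ∀ {P Q R} (s : Tape R P) → (s ⨾ 𝔬 P Q) ≈ 𝔬 R Q
  ⨾-zeroʳ s = ≈-trans (≈-sym (assoc _ _ _)) (⨾-congˡ (!-nat s))

  ⨾-⨾-zero : ∀ {P Q R S} (f : Tape P Q) (g : Tape R S) → (f ⨾ 𝔬 Q R ⨾ g) ≈ 𝔬 P S
  ⨾-⨾-zero f g = ≈-trans (⨾-congʳ (⨾-zeroˡ g)) (⨾-zeroʳ f)

  ⨾-⨾-distrib-+ : ∀ {P Q R S} (f : Tape P Q) (a b : Tape Q R) (g : Tape R S) →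
                  (f ⨾ (a + b) ⨾ g) ≈ ((f ⨾ a ⨾ g) + (f ⨾ b ⨾ g))
  ⨾-⨾-distrib-+ f a b g =
    ≈-trans (⨾-congʳ (⨾-distribʳ-+ a b g)) (⨾-distribˡ-+ _ _ f)

  𝔬⊕𝔬 : ∀ {P Q P' Q'} → (𝔬 P Q ⊕ 𝔬 P' Q') ≈ 𝔬 (P ++ P') (Q ++ Q')
  𝔬⊕𝔬 {P} {Q} {P'} {Q'} =
    ≈-trans (⊕-interchange _ _ _ _) (⨾-cong (≈-sym (!-⊕ P P')) (≈-sym (ι-⊕ Q Q')))

  -- Lets the cast-laden coherence laws be combined without computing casts.
  infix 4 _≋_
  _≋_ : ∀ {P Q P' Q'} → Tape P Q → Tape P' Q' → Set
  _≋_ {P} {Q} {P'} {Q'} t u = Σ (P ≡ P') λ p → Σ (Q ≡ Q') λ q → castT p q t ≈ u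

  ≋⇒≈ : ∀ {P Q} {t u : Tape P Q} → t ≋ u → t ≈ u
  ≋⇒≈ (refl , refl , h) = h

  ≈⇒≋ : ∀ {P Q} {t u : Tape P Q} → t ≈ u → t ≋ u
  ≈⇒≋ h = refl , refl , h

  ≋-sym : ∀ {P Q P' Q'} {t : Tape P Q} {u : Tape P' Q'} → t ≋ u → u ≋ t
  ≋-sym (refl , refl , h) = refl , refl , ≈-sym h

  ≋-trans : ∀ {P Q P' Q' P'' Q''} {t : Tape P Q} {u : Tape P' Q'} {v : Tape P'' Q''} →
            t ≋ u → u ≋ v → t ≋ v
  ≋-trans (refl , refl , h) (refl , refl , g) = refl , refl , ≈-trans h g

  castT-≋ : ∀ {P Q P' Q'} (p : P ≡ P') (q : Q ≡ Q') (t : Tape P Q) → castT p q t ≋ t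
  castT-≋ refl refl t = ≈⇒≋ ≈-refl

  id-≋ : ∀ {P P'} → P ≡ P' → id P ≋ id P'
  id-≋ refl = ≈⇒≋ ≈-refl

  ⨾-≋-cong : ∀ {P Q R P' Q' R'} {t : Tape P Q} {t' : Tape P' Q'}
             {s : Tape Q R} {s' : Tape Q' R'} → t ≋ t' → s ≋ s' → (t ⨾ s) ≋ (t' ⨾ s')
  ⨾-≋-cong (refl , refl , h) (refl , refl , g) = ≈⇒≋ (⨾-cong h g)

  ⊕-≋-cong : ∀ {P Q R S P' Q' R' S'} {t : Tape P Q} {t' : Tape P' Q'}
             {s : Tape R S} {s' : Tape R' S'} → t ≋ t' → s ≋ s' → (t ⊕ s) ≋ (t' ⊕ s')
  ⊕-≋-cong (refl , refl , h) (refl , refl , g) = ≈⇒≋ (⊕-cong h g)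

  ⊕-assoc-≋ : ∀ {P Q P' Q' P'' Q''} (t : Tape P Q) (s : Tape P' Q') (r : Tape P'' Q'') →
              ((t ⊕ s) ⊕ r) ≋ (t ⊕ (s ⊕ r))
  ⊕-assoc-≋ {P} {Q} {P'} {Q'} {P''} {Q''} t s r =
    ++-assoc P P' P'' , ++-assoc Q Q' Q'' , ⊕-assoc t s r

  ⊕-reassoc-≋ : ∀ {A B C D A' B' C' D'}
                (a : Tape A A') (b : Tape B B') (c : Tape C C') (d : Tape D D') →
                ((a ⊕ b) ⊕ (c ⊕ d)) ≋ (a ⊕ ((b ⊕ c) ⊕ d))
  ⊕-reassoc-≋ a b c d =
    ≋-trans (⊕-assoc-≋ a b (c ⊕ d)) (⊕-≋-cong (≈⇒≋ ≈-refl) (≋-sym (⊕-assoc-≋ b c d)))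

  -- The permutation occurring in the coherence laws Δ-⊕ and ∇-⊕.
  middle-swap : (A B C D : Poly) → Tape ((A ++ B) ++ (C ++ D)) ((A ++ C) ++ (B ++ D))
  middle-swap A B C D = castT (interchange-eq A B C D) (interchange-eq A C B D)
                              (id A ⊕ (σ⊕ B C ⊕ id D))

  middle-swap-nat : ∀ {A B C D A' B' C' D'}
                    (a : Tape A A') (b : Tape B B') (c : Tape C C') (d : Tape D D') →
                    (middle-swap A B C D ⨾ ((a ⊕ c) ⊕ (b ⊕ d))) ≈
                    (((a ⊕ b) ⊕ (c ⊕ d)) ⨾ middle-swap A' B' C' D')
  middle-swap-nat {A} {B} {C} {D} {A'} {B'} {C'} {D'} a b c d = ≋⇒≈
    (≋-trans (⨾-≋-cong (castT-≋ _ _ _) (⊕-reassoc-≋ a c b d))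
    (≋-trans (≈⇒≋ unbracketed)
             (≋-sym (⨾-≋-cong (⊕-reassoc-≋ a b c d) (castT-≋ _ _ _)))))
    where
    slide : ∀ {X Y} (t : Tape X Y) → (id X ⨾ t) ≈ (t ⨾ id Y)
    slide t = ≈-trans (idˡ t) (≈-sym (idʳ t))
    unbracketed : ((id A ⊕ (σ⊕ B C ⊕ id D)) ⨾ (a ⊕ ((c ⊕ b) ⊕ d))) ≈
                  ((a ⊕ ((b ⊕ c) ⊕ d)) ⨾ (id A' ⊕ (σ⊕ B' C' ⊕ id D')))
    unbracketed = begin
      (id A ⊕ (σ⊕ B C ⊕ id D)) ⨾ (a ⊕ ((c ⊕ b) ⊕ d))
        ≈⟨ ≈-sym (⊕-interchange _ _ _ _) ⟩
      (id A ⨾ a) ⊕ ((σ⊕ B C ⊕ id D) ⨾ ((c ⊕ b) ⊕ d))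
        ≈⟨ ⊕-cong (slide a) (≈-sym (⊕-interchange _ _ _ _)) ⟩
      (a ⨾ id A') ⊕ ((σ⊕ B C ⨾ (c ⊕ b)) ⊕ (id D ⨾ d))
        ≈⟨ ⊕-cong ≈-refl (⊕-cong (≈-sym (σ-nat b c)) (slide d)) ⟩
      (a ⨾ id A') ⊕ (((b ⊕ c) ⨾ σ⊕ B' C') ⊕ (d ⨾ id D'))
        ≈⟨ ⊕-cong ≈-refl (⊕-interchange _ _ _ _) ⟩
      (a ⨾ id A') ⊕ (((b ⊕ c) ⊕ d) ⨾ (σ⊕ B' C' ⊕ id D'))
        ≈⟨ ⊕-interchange _ _ _ _ ⟩
      (a ⊕ ((b ⊕ c) ⊕ d)) ⨾ (id A' ⊕ (σ⊕ B' C' ⊕ id D')) ∎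
      where open ≈-Reasoning

  middle-swap-inverse : (A B C D : Poly) →
                        (middle-swap A B C D ⨾ middle-swap A C B D) ≈ id ((A ++ B) ++ (C ++ D))
  middle-swap-inverse A B C D = ≋⇒≈
    (≋-trans (⨾-≋-cong (castT-≋ _ _ _) (castT-≋ _ _ _))
    (≋-trans (≈⇒≋ unbracketed) (id-≋ (interchange-eq A B C D))))
    where
    unbracketed : ((id A ⊕ (σ⊕ B C ⊕ id D)) ⨾ (id A ⊕ (σ⊕ C B ⊕ id D))) ≈
                  id (A ++ ((B ++ C) ++ D))
    unbracketed = begin
      (id A ⊕ (σ⊕ B C ⊕ id D)) ⨾ (id A ⊕ (σ⊕ C B ⊕ id D))
        ≈⟨ ≈-sym (⊕-interchange _ _ _ _) ⟩
      (id A ⨾ id A) ⊕ ((σ⊕ B C ⊕ id D) ⨾ (σ⊕ C B ⊕ id D))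
        ≈⟨ ⊕-cong (idˡ _) (≈-sym (⊕-interchange _ _ _ _)) ⟩
      id A ⊕ ((σ⊕ B C ⨾ σ⊕ C B) ⊕ (id D ⨾ id D))
        ≈⟨ ⊕-cong ≈-refl (≈-trans (⊕-cong (σ-inv B C) (idˡ _)) (⊕-id _ _)) ⟩
      id A ⊕ id ((B ++ C) ++ D)
        ≈⟨ ⊕-id _ _ ⟩
      id (A ++ ((B ++ C) ++ D)) ∎
      where open ≈-Reasoning

  ⊕-+ : ∀ {P Q P' Q'} (a b : Tape P Q) (c d : Tape P' Q') →
        ((a + b) ⊕ (c + d)) ≈ ((a ⊕ c) + (b ⊕ d))
  ⊕-+ {P} {Q} {P'} {Q'} a b c d = begin
    (Δ P ⨾ (a ⊕ b) ⨾ ∇ Q) ⊕ (Δ P' ⨾ (c ⊕ d) ⨾ ∇ Q')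
      ≈⟨ ≈-trans (⊕-interchange _ _ _ _) (⨾-congʳ (⊕-interchange _ _ _ _)) ⟩
    (Δ P ⊕ Δ P') ⨾ ((a ⊕ b) ⊕ (c ⊕ d)) ⨾ (∇ Q ⊕ ∇ Q')
      ≈⟨ ⨾-congʳ (⨾-congʳ unswap-∇⊕∇) ⟩
    (Δ P ⊕ Δ P') ⨾ ((a ⊕ b) ⊕ (c ⊕ d)) ⨾ middle-swap Q Q Q' Q' ⨾ M∇
      ≈⟨ ⨾-congʳ (≈-sym (assoc _ _ _)) ⟩
    (Δ P ⊕ Δ P') ⨾ (((a ⊕ b) ⊕ (c ⊕ d)) ⨾ middle-swap Q Q Q' Q') ⨾ M∇
      ≈⟨ ⨾-congʳ (⨾-congˡ (≈-sym (middle-swap-nat a b c d))) ⟩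
    (Δ P ⊕ Δ P') ⨾ (middle-swap P P P' P' ⨾ ((a ⊕ c) ⊕ (b ⊕ d))) ⨾ M∇
      ≈⟨ ≈-trans (⨾-congʳ (assoc _ _ _)) (≈-sym (assoc _ _ _)) ⟩
    ((Δ P ⊕ Δ P') ⨾ middle-swap P P P' P') ⨾ ((a ⊕ c) ⊕ (b ⊕ d)) ⨾ M∇
      ≈⟨ ⨾-cong (≈-sym (Δ-⊕ P P')) (⨾-congʳ (≈-sym (∇-⊕ Q Q'))) ⟩
    Δ (P ++ P') ⨾ ((a ⊕ c) ⊕ (b ⊕ d)) ⨾ ∇ (Q ++ Q') ∎
    where
    open ≈-Reasoning
    M∇ : Tape ((Q ++ Q') ++ (Q ++ Q')) (Q ++ Q')
    M∇ = middle-swap Q Q' Q Q' ⨾ (∇ Q ⊕ ∇ Q')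
    unswap-∇⊕∇ : (∇ Q ⊕ ∇ Q') ≈ (middle-swap Q Q Q' Q' ⨾ M∇)
    unswap-∇⊕∇ = ≈-sym (begin
      middle-swap Q Q Q' Q' ⨾ M∇                   ≈⟨ ≈-sym (assoc _ _ _) ⟩
      (middle-swap Q Q Q' Q' ⨾ middle-swap Q Q' Q Q') ⨾ (∇ Q ⊕ ∇ Q')
        ≈⟨ ⨾-congˡ (middle-swap-inverse Q Q Q' Q') ⟩
      id _ ⨾ (∇ Q ⊕ ∇ Q')                          ≈⟨ idˡ _ ⟩
      ∇ Q ⊕ ∇ Q'                                   ∎)

  castT-+ : ∀ {P Q P' Q'} (p : P ≡ P') (q : Q ≡ Q') (a b : Tape P Q) →
            castT p q (a + b) ≡ (castT p q a + castT p q b)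
  castT-+ refl refl a b = refl

  castT-𝔬 : ∀ {P Q P' Q'} (p : P ≡ P') (q : Q ≡ Q') → castT p q (𝔬 P Q) ≡ 𝔬 P' Q'
  castT-𝔬 refl refl = refl

  castT-⨾-⨾ : ∀ {A B B' C C' D} (p : B' ≡ B) (q : C' ≡ C)
              (x : Tape A B') (y : Tape B' C') (z : Tape C' D) →
              (castT refl p x ⨾ castT p q y ⨾ castT q refl z) ≡ (x ⨾ y ⨾ z)
  castT-⨾-⨾ refl refl x y z = refl

  L-+ : ∀ U {P Q} (a b : Tape P Q) → L U (a + b) ≡ (L U a + L U b)
  L-+ U a b = castT-⨾-⨾ _ _ _ _ _

  R-+ : ∀ U {P Q} (a b : Tape P Q) → R U (a + b) ≡ (R U a + R U b)
  R-+ U a b = castT-⨾-⨾ _ _ _ _ _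

  castT-R-+ : ∀ U {P Q P' Q'} (p : P ·ʳ U ≡ P') (q : Q ·ʳ U ≡ Q') (a b : Tape P Q) →
              castT p q (R U (a + b)) ≡ (castT p q (R U a) + castT p q (R U b))
  castT-R-+ U p q a b = trans (cong (castT p q) (R-+ U a b)) (castT-+ p q _ _)

  Lₚ-+ : ∀ (S : Poly) {P Q} (a b : Tape P Q) → Lₚ S (a + b) ≈ (Lₚ S a + Lₚ S b)
  Lₚ-+ []      a b = ≈-into-empty refl _ _
  Lₚ-+ (W ∷ S) a b = ≈-trans (⊕-cong (≡⇒≈ (L-+ W a b)) (Lₚ-+ S a b)) (⊕-+ _ _ _ _)

  Rₚ-+ : ∀ (S : Poly) {P Q} (a b : Tape P Q) → Rₚ S (a + b) ≈ (Rₚ S a + Rₚ S b)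
  Rₚ-+ []      {Q = Q} a b = ≈-into-empty (⊗ₚ-zeroʳ Q) _ _
  Rₚ-+ (W ∷ S)         a b = ≈-trans
    (⨾-congʳ (⨾-congˡ (≈-trans (⊕-cong (≡⇒≈ (castT-R-+ W _ _ a b)) (Rₚ-+ S a b)) (⊕-+ _ _ _ _))))
    (⨾-⨾-distrib-+ _ _ _ _)

  Lₚ-𝔬 : ∀ (S : Poly) {P Q} → Lₚ S (𝔬 P Q) ≈ 𝔬 (S ⊗ₚ P) (S ⊗ₚ Q)
  Lₚ-𝔬 []      = ≈-into-empty refl _ _
  Lₚ-𝔬 (W ∷ S) = ≈-trans (⊕-cong ≈-refl (Lₚ-𝔬 S)) 𝔬⊕𝔬

  Rₚ-𝔬 : ∀ (S : Poly) {P Q} → Rₚ S (𝔬 P Q) ≈ 𝔬 (P ⊗ₚ S) (Q ⊗ₚ S)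
  Rₚ-𝔬 []      {Q = Q} = ≈-into-empty (⊗ₚ-zeroʳ Q) _ _
  Rₚ-𝔬 (W ∷ S)         = ≈-trans
    (⨾-congʳ (⨾-congˡ (≈-trans (⊕-cong (≡⇒≈ (castT-𝔬 _ _)) (Rₚ-𝔬 S)) 𝔬⊕𝔬)))
    (⨾-⨾-zero _ _)

  ⊗-distribʳ-+ : ∀ {P Q R S} (t₁ t₂ : Tape P Q) (s : Tape R S) →
                 ((t₁ + t₂) ⊗ s) ≈ ((t₁ ⊗ s) + (t₂ ⊗ s))
  ⊗-distribʳ-+ {S = S} t₁ t₂ s = ≈-trans (⨾-congʳ (Rₚ-+ S t₁ t₂)) (⨾-distribˡ-+ _ _ _)

  ⊗-distribˡ-+ : ∀ {P Q R S} (t₁ t₂ : Tape P Q) (s : Tape R S) →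
                 (s ⊗ (t₁ + t₂)) ≈ ((s ⊗ t₁) + (s ⊗ t₂))
  ⊗-distribˡ-+ {R = R} t₁ t₂ s = ≈-trans (⨾-congˡ (Lₚ-+ R t₁ t₂)) (⨾-distribʳ-+ _ _ _)

  ⊗-zeroˡ : ∀ {P Q R S} (s : Tape R S) → (𝔬 P Q ⊗ s) ≈ 𝔬 (P ⊗ₚ R) (Q ⊗ₚ S)
  ⊗-zeroˡ {S = S} s = ≈-trans (⨾-congʳ (Rₚ-𝔬 S)) (⨾-zeroʳ _)

  ⊗-zeroʳ : ∀ {P Q R S} (s : Tape R S) → (s ⊗ 𝔬 P Q) ≈ 𝔬 (R ⊗ₚ P) (S ⊗ₚ Q)
  ⊗-zeroʳ {R = R} s = ≈-trans (⨾-congˡ (Lₚ-𝔬 R)) (⨾-zeroˡ _)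

proposition6p1 :
    (Sg : Signature) → let open FreeFB Sg in
      -- (1)
      (∀ {P Q R} (t₁ t₂ : Tape P Q) (s : Tape Q R) →
         ((t₁ + t₂) ⨾ s) ≈ ((t₁ ⨾ s) + (t₂ ⨾ s)))
      -- (2)
      × (∀ {P Q R} (t₁ t₂ : Tape P Q) (s : Tape R P) →
         (s ⨾ (t₁ + t₂)) ≈ ((s ⨾ t₁) + (s ⨾ t₂)))
      -- (3)
      × (∀ {P Q R} (s : Tape Q R) → (𝔬 P Q ⨾ s) ≈ 𝔬 P R)
      × (∀ {P Q R} (s : Tape R P) → (s ⨾ 𝔬 P Q) ≈ 𝔬 R Q)
      -- (4)
      × (∀ {P Q R S} (t₁ t₂ : Tape P Q) (s : Tape R S) →
         ((t₁ + t₂) ⊗ s) ≈ ((t₁ ⊗ s) + (t₂ ⊗ s)))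
      -- (5)
      × (∀ {P Q R S} (t₁ t₂ : Tape P Q) (s : Tape R S) →
         (s ⊗ (t₁ + t₂)) ≈ ((s ⊗ t₁) + (s ⊗ t₂)))
      -- (6)
      × (∀ {P Q R S} (s : Tape R S) → (𝔬 P Q ⊗ s) ≈ 𝔬 (P ⊗ₚ R) (Q ⊗ₚ S))
      × (∀ {P Q R S} (s : Tape R S) → (s ⊗ 𝔬 P Q) ≈ 𝔬 (R ⊗ₚ P) (S ⊗ₚ Q))
proposition6p1 Sg =
  ⨾-distribʳ-+ , ⨾-distribˡ-+ , ⨾-zeroˡ , ⨾-zeroʳ ,
  ⊗-distribʳ-+ , ⊗-distribˡ-+ , ⊗-zeroˡ , ⊗-zeroʳ
  where open Distributivity Sg
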